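{- Let $f$ be an $s$-term DNF with a fixed representation, let $K$ be a positive integer, and let $C$ be any cluster of $\mathrm{Clustering}(f,K)$ with label $(T^*,S^*)$. Then $|S^*|\le 16s^2K$.
   Context: Terms are conjunctions of literals, viewed as sets of literals; no term contains both $x_i$ and $\overline{x_i}$; the width of a term is its number of literals. Fix a total (lexicographic) order on terms. The $K$-clustering $\mathrm{Clustering}(f,K)$ is produced by the following deterministic procedure on the set $L$ of terms of $f$: while $L\neq\emptyset$, pick the first term $T$ (in the fixed order) among the terms of $L$ of minimum width, remove it from $L$, and create a cluster $C=\{T\}$ with label $T^*=T$, $S^*=\emptyset$; then, while there exists $T'\in L$ with $|\{\ell\in T': \ell\notin T^*\cup S^*\}|\le 2K$, pick the first such $T'$, remove it from $L$, add it to $C$, and update simultaneously $T^*\leftarrow T^*\cap T'$ and $S^*\leftarrow S^*\cup\{\ell,\overline{\ell}:\ell\in T^*\triangle T'\}$ (with $T^*$ the value before the update); when no such $T'$ exists, the cluster $C$ with its current label is finished. The output is the collection of clusters. -}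

module Defs where

open import Data.Nat using (ℕ; zero; suc; _+_; _*_; _≤ᵇ_; _≡ᵇ_)
open import Data.Nat as ℕ using (_⊔_)
open import Data.Bool using (Bool; true; false; _∧_; _∨_; not; _xor_; T)
open import Data.Product using (_×_; _,_)
open import Data.Maybe using (Maybe; just; nothing)
open import Data.List using (List; []; _∷_; _++_; [_]; length)
open import Data.Vec using (Vec; zipWith; replicate)
import Data.Vec as V
open import Data.Vec.Relation.Unary.All using (All)

-- Variables x_0 … x_{n-1}.  A set of literals over n variables is a vector
-- giving, for each variable i, the pair (x_i ∈ set , ¬x_i ∈ set).
LitSet : ℕ → Set
LitSet n = Vec (Bool × Bool) n

Term : ℕ → Set
Term = LitSet

Consistent : ∀ {n} → Term n → Set
Consistent t = All (λ { (a , b) → T (not (a ∧ b)) }) t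

b2n : Bool → ℕ
b2n true = 1
b2n false = 0

card : ∀ {n} → LitSet n → ℕ
card v = V.sum (V.map (λ { (a , b) → b2n a + b2n b }) v)

width : ∀ {n} → Term n → ℕ
width = card

∅ : ∀ {n} → LitSet n
∅ = replicate _ (false , false)

_∩_ : ∀ {n} → LitSet n → LitSet n → LitSet n
_∩_ = zipWith (λ { (a , b) (c , d) → (a ∧ c , b ∧ d) })

_∪_ : ∀ {n} → LitSet n → LitSet n → LitSet n
_∪_ = zipWith (λ { (a , b) (c , d) → (a ∨ c , b ∨ d) })

_∖_ : ∀ {n} → LitSet n → LitSet n → LitSet n
_∖_ = zipWith (λ { (a , b) (c , d) → (a ∧ not c , b ∧ not d) })

_△_ : ∀ {n} → LitSet n → LitSet n → LitSet n
_△_ = zipWith (λ { (a , b) (c , d) → (a xor c , b xor d) })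

closeNeg : ∀ {n} → LitSet n → LitSet n
closeNeg = V.map (λ { (a , b) → (a ∨ b , a ∨ b) })

pickFirst : {A : Set} → (A → Bool) → List A → Maybe (A × List A)
pickFirst p [] = nothing
pickFirst p (x ∷ xs) with p x
... | true = just (x , xs)
... | false with pickFirst p xs
...   | nothing = nothing
...   | just (y , ys) = just (y , x ∷ ys)

minWidth : ∀ {n} → List (Term n) → ℕ
minWidth [] = 0
minWidth (t ∷ []) = width t
minWidth (t ∷ u ∷ ts) = ℕ._⊓_ (width t) (minWidth (u ∷ ts))

record Cluster (n : ℕ) : Set where
  constructor mkCluster
  field
    members : List (Term n)
    Tstar   : LitSet n
    Sstar   : LitSet n
open Cluster public

module _ {n : ℕ} (K : ℕ) where

  -- grow the current cluster; fuel bounds the number of terms still in L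
  grow : ℕ → LitSet n → LitSet n → List (Term n) → List (Term n)
       → Cluster n × List (Term n)
  grow zero Ts Ss C L = mkCluster C Ts Ss , L
  grow (suc f) Ts Ss C L
    with pickFirst (λ T' → card (T' ∖ (Ts ∪ Ss)) ≤ᵇ (2 * K)) L
  ... | nothing = mkCluster C Ts Ss , L
  ... | just (T' , L') = grow f (Ts ∩ T') (Ss ∪ closeNeg (Ts △ T')) (C ++ [ T' ]) L'

  clusterLoop : ℕ → List (Term n) → List (Cluster n)
  clusterLoop zero L = []
  clusterLoop (suc f) L with pickFirst (λ t → width t ≡ᵇ minWidth L) L
  ... | nothing = []
  ... | just (t , L') with grow (length L') t ∅ [ t ] L'
  ...   | c , L'' = c ∷ clusterLoop f L''

  -- The list order of L is the fixed total order on terms.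
  -- Each iteration removes at least one term, so fuel = length L suffices.
  Clustering : List (Term n) → List (Cluster n)
  Clustering L = clusterLoop (length L) L

{-# OPTIONS --safe #-}
module Submission where

-- Call the literals of T' outside T* ∪ S* fresh; a term joins a cluster only if it has at most
-- 2K of them.  Along the growth of a cluster the label stays well formed: T* is consistent,
-- S* is closed under negation, and no variable occurs in both.  Then the potential
-- 2|T*| + |S*| increases by at most twice the number of fresh literals, so after j merges it is
-- at most 2w₀ + 4Kj, where w₀ is the width of the seed, a minimum-width term.  A consistent
-- merged term T' meets each variable of S* in at most one literal, so
-- 2w₀ ≤ 2|T'| ≤ 2|T* ∩ T'| + |S*| + 2·fresh; the new T* is therefore not much smaller than w₀,
-- which leaves |S*| room to grow by at most 4Kj + 8K in the merge following j earlier ones.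
-- Hence |S*| ≤ 8Kj² after j merges, and a cluster has fewer than s merges.

open import Defs
open import Data.Nat using (ℕ; _*_; _≤_; _^_; NonZero)
open import Data.List using (List; length)
open import Data.List.Relation.Unary.All using (All)
open import Data.List.Relation.Unary.Unique.Propositional using (Unique)
open import Data.List.Membership.Propositional using (_∈_)

open import Data.Nat using (zero; suc; _+_; _≤ᵇ_; _≡ᵇ_; z≤n)
open import Data.Nat.Properties
  using ( ≤ᵇ⇒≤; ≡ᵇ⇒≡; ≤-refl; ≤-reflexive; ≤-trans; +-mono-≤; +-monoˡ-≤; *-mono-≤; *-monoʳ-≤
        ; *-distribˡ-+; *-zeroʳ; +-cancelˡ-≤; +-suc; m≤m+n; m⊓n≤m; m⊓n≤n; module ≤-Reasoning )
open import Data.Nat.Tactic.RingSolver using (solve-∀)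
open import Data.Bool using (Bool; true; false; _∧_; _∨_; not; _xor_; T)
open import Data.Unit using (tt)
open import Data.Product using (_×_; _,_; proj₁; proj₂; ∃-syntax)
open import Data.Maybe using (just; nothing)
open import Data.List using ([]; _∷_; [_])
open import Data.List.Relation.Unary.Any using (here; there)
import Data.List.Relation.Unary.All as List
open import Data.List.Relation.Binary.Sublist.Propositional using (_⊆_; _∷ʳ_; _∷_; ⊆-refl; ⊆-trans)
open import Data.List.Relation.Binary.Sublist.Propositional.Properties
  using (All-resp-⊆; Any-resp-⊆; length-mono-≤)
open import Data.Vec using ([]; _∷_)
import Data.Vec.Relation.Unary.All as Vec
open import Data.Vec.Relation.Binary.Pointwise.Inductive using (Pointwise; []; _∷_)
open import Relation.Binary.PropositionalEquality using (_≡_; refl; sym; trans; cong; subst; subst₂)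

-- The operations of Defs restricted to one variable, so that e.g. card ((x ∷ t) ∩ (z ∷ t'))
-- reduces to card₁ (x ∩₁ z) + card (t ∩ t').
LitSet₁ : Set
LitSet₁ = Bool × Bool

card₁ : LitSet₁ → ℕ
card₁ (a , b) = b2n a + b2n b

Consistent₁ : LitSet₁ → Set
Consistent₁ (a , b) = T (not (a ∧ b))

_∩₁_ _∪₁_ _∖₁_ _△₁_ : LitSet₁ → LitSet₁ → LitSet₁
(a , b) ∩₁ (c , d) = (a ∧ c , b ∧ d)
(a , b) ∪₁ (c , d) = (a ∨ c , b ∨ d)
(a , b) ∖₁ (c , d) = (a ∧ not c , b ∧ not d)
(a , b) △₁ (c , d) = (a xor c , b xor d)

closeNeg₁ : LitSet₁ → LitSet₁
closeNeg₁ (a , b) = (a ∨ b , a ∨ b)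

data WellFormed₁ : LitSet₁ → LitSet₁ → Set where
  unused   : WellFormed₁ (false , false) (false , false)
  positive : WellFormed₁ (true , false) (false , false)
  negative : WellFormed₁ (false , true) (false , false)
  blocked  : WellFormed₁ (false , false) (true , true)

wellFormed₁-merge : ∀ {x y} → WellFormed₁ x y → ∀ z → Consistent₁ z
  → WellFormed₁ (x ∩₁ z) (y ∪₁ closeNeg₁ (x △₁ z))
wellFormed₁-merge _        (true , true)   ()
wellFormed₁-merge unused   (false , false) _ = unused
wellFormed₁-merge unused   (true , false)  _ = blocked
wellFormed₁-merge unused   (false , true)  _ = blocked
wellFormed₁-merge positive (false , false) _ = blocked
wellFormed₁-merge positive (true , false)  _ = positive
wellFormed₁-merge positive (false , true)  _ = blocked
wellFormed₁-merge negative (false , false) _ = blocked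
wellFormed₁-merge negative (true , false)  _ = blocked
wellFormed₁-merge negative (false , true)  _ = negative
wellFormed₁-merge blocked  (false , false) _ = blocked
wellFormed₁-merge blocked  (true , false)  _ = blocked
wellFormed₁-merge blocked  (false , true)  _ = blocked

potential₁-merge : ∀ {x y} → WellFormed₁ x y → ∀ z
  → 2 * card₁ (x ∩₁ z) + card₁ (y ∪₁ closeNeg₁ (x △₁ z))
    ≤ 2 * card₁ x + card₁ y + 2 * card₁ (z ∖₁ (x ∪₁ y))
potential₁-merge unused   (false , false) = ≤ᵇ⇒≤ _ _ tt
potential₁-merge unused   (false , true)  = ≤ᵇ⇒≤ _ _ tt
potential₁-merge unused   (true , false)  = ≤ᵇ⇒≤ _ _ tt
potential₁-merge unused   (true , true)   = ≤ᵇ⇒≤ _ _ tt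
potential₁-merge positive (false , false) = ≤ᵇ⇒≤ _ _ tt
potential₁-merge positive (false , true)  = ≤ᵇ⇒≤ _ _ tt
potential₁-merge positive (true , false)  = ≤ᵇ⇒≤ _ _ tt
potential₁-merge positive (true , true)   = ≤ᵇ⇒≤ _ _ tt
potential₁-merge negative (false , false) = ≤ᵇ⇒≤ _ _ tt
potential₁-merge negative (false , true)  = ≤ᵇ⇒≤ _ _ tt
potential₁-merge negative (true , false)  = ≤ᵇ⇒≤ _ _ tt
potential₁-merge negative (true , true)   = ≤ᵇ⇒≤ _ _ tt
potential₁-merge blocked  (false , false) = ≤ᵇ⇒≤ _ _ tt
potential₁-merge blocked  (false , true)  = ≤ᵇ⇒≤ _ _ tt
potential₁-merge blocked  (true , false)  = ≤ᵇ⇒≤ _ _ tt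
potential₁-merge blocked  (true , true)   = ≤ᵇ⇒≤ _ _ tt

width₁-split : ∀ {x y} → WellFormed₁ x y → ∀ z → Consistent₁ z
  → 2 * card₁ z ≤ 2 * card₁ (x ∩₁ z) + card₁ y + 2 * card₁ (z ∖₁ (x ∪₁ y))
width₁-split _        (true , true)   ()
width₁-split unused   (false , false) _ = ≤ᵇ⇒≤ _ _ tt
width₁-split unused   (true , false)  _ = ≤ᵇ⇒≤ _ _ tt
width₁-split unused   (false , true)  _ = ≤ᵇ⇒≤ _ _ tt
width₁-split positive (false , false) _ = ≤ᵇ⇒≤ _ _ tt
width₁-split positive (true , false)  _ = ≤ᵇ⇒≤ _ _ tt
width₁-split positive (false , true)  _ = ≤ᵇ⇒≤ _ _ tt
width₁-split negative (false , false) _ = ≤ᵇ⇒≤ _ _ tt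
width₁-split negative (true , false)  _ = ≤ᵇ⇒≤ _ _ tt
width₁-split negative (false , true)  _ = ≤ᵇ⇒≤ _ _ tt
width₁-split blocked  (false , false) _ = ≤ᵇ⇒≤ _ _ tt
width₁-split blocked  (true , false)  _ = ≤ᵇ⇒≤ _ _ tt
width₁-split blocked  (false , true)  _ = ≤ᵇ⇒≤ _ _ tt

WellFormed : ∀ {n} → LitSet n → LitSet n → Set
WellFormed = Pointwise WellFormed₁

wellFormed-∅ : ∀ {n} (t : Term n) → Consistent t → WellFormed t ∅
wellFormed-∅ []                    Vec.[]        = []
wellFormed-∅ ((false , false) ∷ t) (_ Vec.∷ c)  = unused ∷ wellFormed-∅ t c
wellFormed-∅ ((true , false)  ∷ t) (_ Vec.∷ c)  = positive ∷ wellFormed-∅ t c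
wellFormed-∅ ((false , true)  ∷ t) (_ Vec.∷ c)  = negative ∷ wellFormed-∅ t c
wellFormed-∅ ((true , true)   ∷ t) (() Vec.∷ _)

wellFormed-merge : ∀ {n} {t s : LitSet n} → WellFormed t s → (t' : Term n) → Consistent t'
  → WellFormed (t ∩ t') (s ∪ closeNeg (t △ t'))
wellFormed-merge []        []       Vec.[]        = []
wellFormed-merge (xy ∷ ts) (z ∷ t') (cz Vec.∷ c) = wellFormed₁-merge xy z cz ∷ wellFormed-merge ts t' c

private
  +-interchange-2a+b : ∀ a b A B → (2 * a + b) + (2 * A + B) ≡ 2 * (a + A) + (b + B)
  +-interchange-2a+b = solve-∀

  +-interchange-2a+b+2c : ∀ a b c A B C
    → (2 * a + b + 2 * c) + (2 * A + B + 2 * C) ≡ 2 * (a + A) + (b + B) + 2 * (c + C)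
  +-interchange-2a+b+2c = solve-∀

-- The leading summands are passed explicitly: unification cannot solve metavariables
-- under 2 * _ + _.
potential-merge : ∀ {n} {t s : LitSet n} → WellFormed t s → (t' : LitSet n)
  → 2 * card (t ∩ t') + card (s ∪ closeNeg (t △ t')) ≤ 2 * card t + card s + 2 * card (t' ∖ (t ∪ s))
potential-merge []        []       = z≤n
potential-merge {t = x ∷ t} {y ∷ s} (xy ∷ ts) (z ∷ t') =
  subst₂ _≤_ (+-interchange-2a+b (card₁ (x ∩₁ z)) _ (card (t ∩ t')) _)
             (+-interchange-2a+b+2c (card₁ x) _ (card₁ (z ∖₁ (x ∪₁ y))) (card t) _ (card (t' ∖ (t ∪ s))))
    (+-mono-≤ (potential₁-merge xy z) (potential-merge ts t'))

width-split : ∀ {n} {t s : LitSet n} → WellFormed t s → (t' : Term n) → Consistent t'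
  → 2 * card t' ≤ 2 * card (t ∩ t') + card s + 2 * card (t' ∖ (t ∪ s))
width-split []        []       Vec.[]        = z≤n
width-split {t = x ∷ t} {y ∷ s} (xy ∷ ts) (z ∷ t') (cz Vec.∷ c) =
  subst₂ _≤_ (sym (*-distribˡ-+ 2 (card₁ z) (card t')))
             (+-interchange-2a+b+2c (card₁ (x ∩₁ z)) _ (card₁ (z ∖₁ (x ∪₁ y)))
                                    (card (t ∩ t')) _ (card (t' ∖ (t ∪ s))))
    (+-mono-≤ (width₁-split xy z cz) (width-split ts t' c))

card-∅ : ∀ n → card (∅ {n}) ≡ 0
card-∅ zero    = refl
card-∅ (suc n) = card-∅ n

potential-step : ∀ {K w₀ j Φ Φ' d} → Φ' ≤ Φ + 2 * d → d ≤ 2 * K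
  → Φ ≤ 2 * w₀ + 4 * K * j → Φ' ≤ 2 * w₀ + 4 * K * suc j
potential-step {K} {w₀} {j} {Φ} {Φ'} {d} Φ'≤ d≤ Φ≤ = begin
  Φ'                               ≤⟨ Φ'≤ ⟩
  Φ + 2 * d                        ≤⟨ +-mono-≤ Φ≤ (*-monoʳ-≤ 2 d≤) ⟩
  2 * w₀ + 4 * K * j + 2 * (2 * K) ≡⟨ regroup w₀ K j ⟩
  2 * w₀ + 4 * K * suc j           ∎
  where
  open ≤-Reasoning
  regroup : ∀ w₀ K j → 2 * w₀ + 4 * K * j + 2 * (2 * K) ≡ 2 * w₀ + 4 * K * (1 + j)
  regroup = solve-∀

Sstar-step : ∀ {K w₀ w j I σ I' σ' d}
  → 2 * I' + σ' ≤ 2 * I + σ + 2 * d → 2 * w ≤ 2 * I' + σ + 2 * d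
  → w₀ ≤ w → d ≤ 2 * K
  → 2 * I + σ ≤ 2 * w₀ + 4 * K * j → σ ≤ 8 * K * (j * j)
  → σ' ≤ 8 * K * (suc j * suc j)
Sstar-step {K} {w₀} {w} {j} {I} {σ} {I'} {σ'} {d} potential≤ width≤ w₀≤w d≤ Φ≤ σ≤ = begin
  σ'                                             ≤⟨ +-cancelˡ-≤ (2 * w₀) _ _ shifted ⟩
  8 * K * (j * j) + 4 * K * j + 8 * K            ≤⟨ m≤m+n _ (12 * K * j) ⟩
  8 * K * (j * j) + 4 * K * j + 8 * K + 12 * K * j ≡⟨ expand K j ⟩
  8 * K * (suc j * suc j)                        ∎
  where
  open ≤-Reasoning
  expand : ∀ K j → 8 * K * (j * j) + 4 * K * j + 8 * K + 12 * K * j ≡ 8 * K * ((1 + j) * (1 + j))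
  expand = solve-∀
  regroup₁ : ∀ I' σ σ' d → 2 * I' + σ + 2 * d + σ' ≡ (2 * I' + σ') + (σ + 2 * d)
  regroup₁ = solve-∀
  regroup₂ : ∀ Φ σ d → Φ + 2 * d + (σ + 2 * d) ≡ Φ + σ + 2 * (2 * d)
  regroup₂ = solve-∀
  regroup₃ : ∀ w₀ K j s → 2 * w₀ + 4 * K * j + s + 2 * (2 * (2 * K)) ≡ 2 * w₀ + (s + 4 * K * j + 8 * K)
  regroup₃ = solve-∀
  shifted : 2 * w₀ + σ' ≤ 2 * w₀ + (8 * K * (j * j) + 4 * K * j + 8 * K)
  shifted = begin
    2 * w₀ + σ'                     ≤⟨ +-monoˡ-≤ σ' (*-monoʳ-≤ 2 w₀≤w) ⟩
    2 * w + σ'                      ≤⟨ +-monoˡ-≤ σ' width≤ ⟩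
    2 * I' + σ + 2 * d + σ'         ≡⟨ regroup₁ I' σ σ' d ⟩
    (2 * I' + σ') + (σ + 2 * d)     ≤⟨ +-monoˡ-≤ (σ + 2 * d) potential≤ ⟩
    2 * I + σ + 2 * d + (σ + 2 * d) ≡⟨ regroup₂ (2 * I + σ) σ d ⟩
    2 * I + σ + σ + 2 * (2 * d)     ≤⟨ +-mono-≤ (+-mono-≤ Φ≤ σ≤) (*-monoʳ-≤ 2 (*-monoʳ-≤ 2 d≤)) ⟩
    2 * w₀ + 4 * K * j + 8 * K * (j * j) + 2 * (2 * (2 * K)) ≡⟨ regroup₃ w₀ K j (8 * K * (j * j)) ⟩
    2 * w₀ + (8 * K * (j * j) + 4 * K * j + 8 * K) ∎

record LabelBound {n : ℕ} (K w₀ j : ℕ) (t s : LitSet n) : Set where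
  field
    wellFormed : WellFormed t s
    potential  : 2 * card t + card s ≤ 2 * w₀ + 4 * K * j
    Sstar-size : card s ≤ 8 * K * (j * j)

labelBound-seed : ∀ {n} K (t : Term n) → Consistent t → LabelBound K (width t) 0 t ∅
labelBound-seed {n} K t consistent = record
  { wellFormed = wellFormed-∅ t consistent
  ; potential  = ≤-reflexive (cong (2 * card t +_) (trans (card-∅ n) (sym (*-zeroʳ (4 * K)))))
  ; Sstar-size = ≤-reflexive (trans (card-∅ n) (sym (*-zeroʳ (8 * K))))
  }

labelBound-merge : ∀ {n K w₀ j} {t s : LitSet n} (t' : Term n) → Consistent t' → w₀ ≤ width t'
  → card (t' ∖ (t ∪ s)) ≤ 2 * K
  → LabelBound K w₀ j t s → LabelBound K w₀ (suc j) (t ∩ t') (s ∪ closeNeg (t △ t'))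
labelBound-merge {K = K} {w₀} {j} {t} t' consistent w₀≤ fresh≤ b = record
  { wellFormed = wellFormed-merge wellFormed t' consistent
  ; potential  = potential-step {K} {w₀} {j} (potential-merge wellFormed t') fresh≤ potential
  ; Sstar-size = Sstar-step {K} {j = j} {I = card t} {I' = card (t ∩ t')}
                   (potential-merge wellFormed t') (width-split wellFormed t' consistent)
                   w₀≤ fresh≤ potential Sstar-size
  }
  where open LabelBound b

pickFirst-just : ∀ {A : Set} (p : A → Bool) (xs : List A) {y ys}
  → pickFirst p xs ≡ just (y , ys) → T (p y) × y ∈ xs × ys ⊆ xs
pickFirst-just p (x ∷ xs) eq with p x in px
pickFirst-just p (x ∷ xs) refl | true = subst T (sym px) tt , here refl , x ∷ʳ ⊆-refl
... | false with pickFirst p xs in rest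
pickFirst-just p (x ∷ xs) refl | false | just (y , ys) =
  let (py , y∈xs , ys⊆xs) = pickFirst-just p xs rest
  in py , there y∈xs , refl ∷ ys⊆xs

minWidth≤width : ∀ {n} (L : List (Term n)) → All (λ u → minWidth L ≤ width u) L
minWidth≤width []           = List.[]
minWidth≤width (t ∷ [])     = ≤-refl List.∷ List.[]
minWidth≤width (t ∷ u ∷ ts) =
  m⊓n≤m (width t) (minWidth (u ∷ ts))
  List.∷ List.map (≤-trans (m⊓n≤n (width t) (minWidth (u ∷ ts)))) (minWidth≤width (u ∷ ts))

pickFirst-minWidth : ∀ {n} (L : List (Term n)) {t L'}
  → pickFirst (λ u → width u ≡ᵇ minWidth L) L ≡ just (t , L') → All (λ u → width t ≤ width u) L'
pickFirst-minWidth L picked =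
  let (isMin , _ , L'⊆L) = pickFirst-just _ L picked
  in All-resp-⊆ L'⊆L (List.map (subst (_≤ _) (sym (≡ᵇ⇒≡ _ _ isMin))) (minWidth≤width L))

module _ {n : ℕ} (K : ℕ) where

  grow-rest-⊆ : ∀ fuel (t s : LitSet n) C L → proj₂ (grow K fuel t s C L) ⊆ L
  grow-rest-⊆ zero    t s C L = ⊆-refl
  grow-rest-⊆ (suc f) t s C L with pickFirst (λ t' → card (t' ∖ (t ∪ s)) ≤ᵇ (2 * K)) L in picked
  ... | nothing        = ⊆-refl
  ... | just (t' , L') = ⊆-trans (grow-rest-⊆ f _ _ _ L') (proj₂ (proj₂ (pickFirst-just _ L picked)))

  grow-invariant : (Inv : ℕ → LitSet n → LitSet n → Set) {L₀ : List (Term n)}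
    → (∀ {j t s t'} → t' ∈ L₀ → card (t' ∖ (t ∪ s)) ≤ 2 * K
                    → Inv j t s → Inv (suc j) (t ∩ t') (s ∪ closeNeg (t △ t')))
    → ∀ fuel j t s C L → L ⊆ L₀ → Inv j t s
    → let c = proj₁ (grow K fuel t s C L) in ∃[ i ] i ≤ j + fuel × Inv i (Tstar c) (Sstar c)
  grow-invariant Inv merge zero    j t s C L L⊆ inv = j , m≤m+n j 0 , inv
  grow-invariant Inv merge (suc f) j t s C L L⊆ inv
    with pickFirst (λ t' → card (t' ∖ (t ∪ s)) ≤ᵇ (2 * K)) L in picked
  ... | nothing        = j , m≤m+n j (suc f) , inv
  ... | just (t' , L') =
    let (fresh≤ , t'∈L , L'⊆L) = pickFirst-just _ L picked
        (i , i≤ , inv') = grow-invariant Inv merge f (suc j) _ _ _ L' (⊆-trans L'⊆L L⊆)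
                            (merge (Any-resp-⊆ L⊆ t'∈L) (≤ᵇ⇒≤ _ _ fresh≤) inv)
    in i , ≤-trans i≤ (≤-reflexive (sym (+-suc j f))) , inv'

  clusterLoop-All : (P : Cluster n → Set) {L₀ : List (Term n)}
    → (∀ {L t L'} → L ⊆ L₀ → pickFirst (λ u → width u ≡ᵇ minWidth L) L ≡ just (t , L')
                  → P (proj₁ (grow K (length L') t ∅ [ t ] L')))
    → ∀ fuel L → L ⊆ L₀ → All P (clusterLoop K fuel L)
  clusterLoop-All P seeded zero    L L⊆ = List.[]
  clusterLoop-All P seeded (suc f) L L⊆ with pickFirst (λ u → width u ≡ᵇ minWidth L) L in picked
  ... | nothing       = List.[]
  ... | just (t , L') with grow K (length L') t ∅ [ t ] L' in grown
  ...   | c , L'' =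
    subst P (cong proj₁ grown) (seeded L⊆ picked)
    List.∷ clusterLoop-All P seeded f L''
             (⊆-trans (subst (_⊆ L') (cong proj₂ grown) (grow-rest-⊆ (length L') t ∅ [ t ] L'))
                      (⊆-trans (proj₂ (proj₂ (pickFirst-just _ L picked))) L⊆))

  grow-Sstar≤ : (t : Term n) (L : List (Term n)) → Consistent t → All Consistent L
    → All (λ u → width t ≤ width u) L
    → card (Sstar (proj₁ (grow K (length L) t ∅ [ t ] L))) ≤ 8 * K * (length L * length L)
  grow-Sstar≤ t L consistent-t consistent wide =
    let (i , i≤ , bound) = grow-invariant (LabelBound K (width t)) merge (length L) 0 t ∅ [ t ] L ⊆-refl
                             (labelBound-seed K t consistent-t)
    in ≤-trans (LabelBound.Sstar-size bound) (*-monoʳ-≤ (8 * K) (*-mono-≤ i≤ i≤))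
    where
    merge : ∀ {j t₁ s t'} → t' ∈ L → card (t' ∖ (t₁ ∪ s)) ≤ 2 * K
          → LabelBound K (width t) j t₁ s → LabelBound K (width t) (suc j) (t₁ ∩ t') (s ∪ closeNeg (t₁ △ t'))
    merge t'∈L = labelBound-merge _ (List.lookup consistent t'∈L) (List.lookup wide t'∈L)

  seeded-Sstar≤ : {L₀ L : List (Term n)} {t : Term n} {L' : List (Term n)} → All Consistent L₀ → L ⊆ L₀
    → pickFirst (λ u → width u ≡ᵇ minWidth L) L ≡ just (t , L')
    → card (Sstar (proj₁ (grow K (length L') t ∅ [ t ] L'))) ≤ 8 * K * (length L₀ * length L₀)
  seeded-Sstar≤ {L = L} {t} {L'} consistent L⊆ picked =
    let (_ , t∈L , L'⊆L) = pickFirst-just _ L picked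
        L'⊆L₀ = ⊆-trans L'⊆L L⊆
        length≤ = length-mono-≤ L'⊆L₀
    in ≤-trans (grow-Sstar≤ t L' (List.lookup consistent (Any-resp-⊆ L⊆ t∈L))
                            (All-resp-⊆ L'⊆L₀ consistent) (pickFirst-minWidth L picked))
               (*-monoʳ-≤ (8 * K) (*-mono-≤ length≤ length≤))

lemma13 : (n : ℕ) (f : List (Term n)) → All Consistent f → Unique f
    → (K : ℕ) → NonZero K
    → (C : Cluster n) → C ∈ Clustering K f
    → card (Sstar C) ≤ 16 * (length f ^ 2) * K
lemma13 n f consistent _ K _ C C∈ =
  ≤-trans (List.lookup (clusterLoop-All K _ (seeded-Sstar≤ K consistent) (length f) f ⊆-refl) C∈)
          (≤-trans (m≤m+n _ _) (≤-reflexive (double (length f) K)))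
  where
  double : ∀ m K → 8 * K * (m * m) + 8 * K * (m * m) ≡ 16 * (m * (m * 1)) * K
  double = solve-∀
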